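{- Let $M_n$ denote the $n$th Motzkin number. The set $\{n \in \mathbb{N} : M_n \equiv 0 \pmod 5\}$ has asymptotic density $\frac{1}{10}$.
   Context: $\mathbb{N} = \{0,1,2,\dots\}$. The Motzkin numbers are $M_n = \sum_{k \geq 0} \binom{n}{2k} C_k$ for $n \in \mathbb{N}$, where $C_k = \frac{1}{k+1}\binom{2k}{k}$ is the $k$th Catalan number. The asymptotic density of a subset $A \subseteq \mathbb{N}$ is $\lim_{N\to\infty} \frac{1}{N}\#\{n \in A : n \leq N\}$, if this limit exists. -}

module Defs where

open import Level using (Level)
open import Data.Nat using (ℕ; zero; suc; _+_; _*_; _≤_)
open import Data.Nat.DivMod using (_/_)
open import Data.Nat.Combinatorics using (_C_)
open import Data.Integer using (+_)
open import Data.Rational using (ℚ; 0ℚ; _-_; _<_; ∣_∣) renaming (_/_ to _/ℚ_)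
open import Data.Bool using (if_then_else_)
open import Data.Product using (∃-syntax)
open import Relation.Nullary using (does)
open import Relation.Unary using (Pred; Decidable)

-- Catalan number C_k = (1/(k+1)) * binom(2k, k)   (exact division)
catalan : ℕ → ℕ
catalan k = ((2 * k) C k) / suc k

sumTo : ℕ → (ℕ → ℕ) → ℕ
sumTo zero    f = f 0
sumTo (suc n) f = sumTo n f + f (suc n)

-- Motzkin number M_n = Σ_{k ≥ 0} binom(n, 2k) C_k
-- (terms with 2k > n vanish, so summing k = 0..n suffices)
motzkin : ℕ → ℕ
motzkin n = sumTo n (λ k → (n C (2 * k)) * catalan k)

countUpTo : ∀ {ℓ} {P : Pred ℕ ℓ} → Decidable P → ℕ → ℕ
countUpTo P? zero    = if does (P? 0) then 1 else 0
countUpTo P? (suc N) = countUpTo P? N + (if does (P? (suc N)) then 1 else 0)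

-- c / N as a rational (value at N = 0 is irrelevant for the limit; set to 0)
ratio : ℕ → ℕ → ℚ
ratio c zero    = 0ℚ
ratio c (suc n) = (+ c) /ℚ suc n

HasDensity : ∀ {ℓ} {A : Pred ℕ ℓ} → Decidable A → ℚ → Set
HasDensity A? d =
  ∀ (ε : ℚ) → 0ℚ < ε →
    ∃[ N₀ ] ∀ (N : ℕ) → N₀ ≤ N → ∣ ratio (countUpTo A? N) N - d ∣ < ε

{-# OPTIONS --safe #-}
module Submission where

-- Since C_k = C(2k,k) − C(2k,k+1), the Motzkin number M_n is the difference T(n,0) − T(n,2)
-- of trinomial coefficients, the coefficients of (1 + x + x⁻¹)ⁿ. Modulo 5,
-- (1 + x + x⁻¹)⁵ ≡ 1 + x⁵ + x⁻⁵, which gives a Lucas-type recursion for T(n, j) along the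
-- base-5 digits of n. As T(n,0) is never divisible by 5, the ratio ρ(n) = T(n,1)/T(n,0) in 𝔽₅
-- is computed by a finite automaton: a last digit 0, 1, 2, 3 sets ρ to 0, 1, 4, 3, and a last
-- digit 4 applies the involution t ↦ 4 + 4t. Moreover 5 ∣ M_n exactly when n ends in the digit 3
-- with ρ(⌊n/5⌋) = 4, or in the digit 4 with ρ(⌊n/5⌋) = 1. Hence each of the four values of ρ has
-- density 1/4, with counting error O(log n), and the zeros of M_n mod 5 have density
-- 1/5 · 1/4 + 1/5 · 1/4 = 1/10.

open import Defs
open import Data.Nat using (_%_)
open import Data.Nat.Properties using (_≟_)
open import Data.Integer using (+_)
open import Data.Rational using () renaming (_/_ to _/ℚ_)

open import Level using (0ℓ)
open import Data.Nat
open import Data.Nat.Properties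
open import Data.Nat.Combinatorics using (_C_; nCk+nC[k+1]≡[n+1]C[k+1]; k>n⇒nCk≡0; nCk≡nC[n∸k]; nC1≡n)
open import Data.Nat.Coprimality using (Coprime)
open import Data.Nat.DivMod
  using (_mod_; %-distribˡ-+; %-distribˡ-*; m%n<n; m≡m%n+[m/n]*n; m*n/n≡m; m/n<m; m<n*o⇒m/o<n)
open import Data.Nat.Induction using (<-rec)
open import Data.Nat.Tactic.RingSolver using (solve-∀)
open import Algebra.Properties.CommutativeSemigroup +-commutativeSemigroup
  using (interchange; xy∙z≈xz∙y; xy∙z≈zy∙x)
open import Data.Bool using (Bool; true; false; if_then_else_)
import Data.Bool.Properties as Bool
open import Data.Fin using (Fin; toℕ)
open import Data.Fin.Patterns
open import Data.Fin.Properties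
  using (toℕ-fromℕ<; fromℕ<-cong; toℕ≤pred[n]; all?) renaming (_≟_ to _≟₅_)
open import Data.Integer as ℤ using (ℤ; +[1+_]; -[1+_]; _⊖_)
import Data.Integer.Properties as ℤP
import Data.Integer.Tactic.RingSolver as ℤ-Solver
open import Data.Rational as ℚ using (ℚ; mkℚ)
import Data.Rational.Properties as ℚP
import Data.Rational.Unnormalised as ℚᵘ
import Data.Rational.Unnormalised.Properties as ℚᵘP
open import Data.Product using (∃-syntax; _×_; _,_)
open import Data.Sum using (inj₁; inj₂)
open import Relation.Nullary using (does; yes; no; ¬?; _→-dec_)
open import Relation.Nullary.Decidable using (from-yes)
open import Relation.Nullary.Negation using (contradiction)
open import Relation.Unary using (Pred; Decidable)
open import Relation.Binary.Bundles using (Setoid)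
import Relation.Binary.Reasoning.Setoid as ≈-Reasoning
open import Relation.Binary.PropositionalEquality hiding ([_])

-- Binomial sums

sumTo-cong : ∀ n {f g : ℕ → ℕ} → (∀ k → f k ≡ g k) → sumTo n f ≡ sumTo n g
sumTo-cong zero    f≗g = f≗g 0
sumTo-cong (suc n) f≗g = cong₂ _+_ (sumTo-cong n f≗g) (f≗g (suc n))

sumTo-+ : ∀ n (f g : ℕ → ℕ) → sumTo n (λ k → f k + g k) ≡ sumTo n f + sumTo n g
sumTo-+ zero    f g = refl
sumTo-+ (suc n) f g = begin
  sumTo n (λ k → f k + g k) + (f (suc n) + g (suc n))
    ≡⟨ cong (_+ (f (suc n) + g (suc n))) (sumTo-+ n f g) ⟩
  sumTo n f + sumTo n g + (f (suc n) + g (suc n))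
    ≡⟨ interchange (sumTo n f) _ _ _ ⟩
  sumTo n f + f (suc n) + (sumTo n g + g (suc n)) ∎
  where open ≡-Reasoning

sumTo-suc : ∀ n (f : ℕ → ℕ) → sumTo (suc n) f ≡ f 0 + sumTo n (λ k → f (suc k))
sumTo-suc zero    f = refl
sumTo-suc (suc n) f = trans (cong (_+ f (suc (suc n))) (sumTo-suc n f)) (+-assoc (f 0) _ _)

sumTo-extend : ∀ n (f : ℕ → ℕ) → f (suc n) ≡ 0 → sumTo (suc n) f ≡ sumTo n f
sumTo-extend n f f[n+1]≡0 = trans (cong (_+_ (sumTo n f)) f[n+1]≡0) (+-identityʳ (sumTo n f))

[n+1]C[k+1]*[k+1]≡[n+1]*nCk : ∀ n k → (suc n C suc k) * suc k ≡ suc n * (n C k)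
[n+1]C[k+1]*[k+1]≡[n+1]*nCk zero    zero    = refl
[n+1]C[k+1]*[k+1]≡[n+1]*nCk zero    (suc k) = refl
[n+1]C[k+1]*[k+1]≡[n+1]*nCk (suc n) zero    =
  trans (*-identityʳ (suc (suc n) C 1)) (trans (nC1≡n (suc (suc n))) (sym (*-identityʳ (suc (suc n)))))
[n+1]C[k+1]*[k+1]≡[n+1]*nCk (suc n) (suc k) = begin
  (suc (suc n) C suc (suc k)) * suc (suc k)
    ≡⟨ cong (_* suc (suc k)) (nCk+nC[k+1]≡[n+1]C[k+1] (suc n) (suc k)) ⟨
  (a + b) * suc (suc k)
    ≡⟨ split a b k ⟩
  a * suc k + a + b * suc (suc k)
    ≡⟨ cong₂ (λ x y → x + a + y) ([n+1]C[k+1]*[k+1]≡[n+1]*nCk n k)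
                                 ([n+1]C[k+1]*[k+1]≡[n+1]*nCk n (suc k)) ⟩
  suc n * (n C k) + a + suc n * (n C suc k)
    ≡⟨ regroup (suc n) (n C k) (n C suc k) a ⟩
  suc n * (n C k + n C suc k) + a
    ≡⟨ cong (λ x → suc n * x + a) (nCk+nC[k+1]≡[n+1]C[k+1] n k) ⟩
  suc n * a + a
    ≡⟨ +-comm (suc n * a) a ⟩
  suc (suc n) * a ∎
  where
  open ≡-Reasoning
  a b : ℕ
  a = suc n C suc k
  b = suc n C suc (suc k)
  split : ∀ a b k → (a + b) * suc (suc k) ≡ a * suc k + a + b * suc (suc k)
  split = solve-∀
  regroup : ∀ m x y a → m * x + a + m * y ≡ m * (x + y) + a
  regroup = solve-∀

[k+1]*[2k]C[k+1]≡k*[2k]Ck : ∀ k → suc k * (2 * k C suc k) ≡ k * (2 * k C k)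
[k+1]*[2k]C[k+1]≡k*[2k]Ck k = +-cancelʳ-≡ (suc k * c) _ _ (begin
  suc k * d + suc k * c         ≡⟨ factor k d c ⟩
  (c + d) * suc k               ≡⟨ cong (_* suc k) (nCk+nC[k+1]≡[n+1]C[k+1] (2 * k) k) ⟩
  (suc (2 * k) C suc k) * suc k ≡⟨ [n+1]C[k+1]*[k+1]≡[n+1]*nCk (2 * k) k ⟩
  suc (2 * k) * c               ≡⟨ split k c ⟩
  k * c + suc k * c             ∎)
  where
  open ≡-Reasoning
  c d : ℕ
  c = 2 * k C k
  d = 2 * k C suc k
  factor : ∀ k d c → suc k * d + suc k * c ≡ (c + d) * suc k
  factor = solve-∀
  split : ∀ k c → suc (2 * k) * c ≡ k * c + suc k * c
  split = solve-∀

catalan+[2k]C[k+1]≡[2k]Ck : ∀ k → catalan k + 2 * k C suc k ≡ 2 * k C k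
catalan+[2k]C[k+1]≡[2k]Ck k = begin
  catalan k + d ≡⟨ cong (_+ d) catalan≡c∸d ⟩
  c ∸ d + d     ≡⟨ m∸n+n≡m d≤c ⟩
  c             ∎
  where
  open ≡-Reasoning
  c d : ℕ
  c = 2 * k C k
  d = 2 * k C suc k
  d≤c : d ≤ c
  d≤c = *-cancelˡ-≤ (suc k)
    (≤-trans (≤-reflexive ([k+1]*[2k]C[k+1]≡k*[2k]Ck k)) (*-monoˡ-≤ c (n≤1+n k)))
  [c∸d]*[k+1]≡c : (c ∸ d) * suc k ≡ c
  [c∸d]*[k+1]≡c = begin
    (c ∸ d) * suc k       ≡⟨ *-comm (c ∸ d) (suc k) ⟩
    suc k * (c ∸ d)       ≡⟨ *-distribˡ-∸ (suc k) c d ⟩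
    suc k * c ∸ suc k * d ≡⟨ cong (suc k * c ∸_) ([k+1]*[2k]C[k+1]≡k*[2k]Ck k) ⟩
    c + k * c ∸ k * c     ≡⟨ m+n∸n≡m c (k * c) ⟩
    c                     ∎
  catalan≡c∸d : catalan k ≡ c ∸ d
  catalan≡c∸d = trans (cong (_/ suc k) (sym [c∸d]*[k+1]≡c)) (m*n/n≡m (c ∸ d) (suc k))

j+2[1+k]≡2+j+2k : ∀ j k → j + 2 * suc k ≡ suc (suc (j + 2 * k))
j+2[1+k]≡2+j+2k = solve-∀

C-pascal² : ∀ n a b → (suc n C suc a) * (suc a C suc b)
                    ≡ (n C a) * (a C b) + (n C a) * (a C suc b) + (n C suc a) * (suc a C suc b)
C-pascal² n a b = begin
  (suc n C suc a) * (suc a C suc b)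
    ≡⟨ cong₂ _*_ (nCk+nC[k+1]≡[n+1]C[k+1] n a) (nCk+nC[k+1]≡[n+1]C[k+1] a b) ⟨
  (n C a + n C suc a) * (a C b + a C suc b)
    ≡⟨ expand (n C a) (n C suc a) (a C b) (a C suc b) ⟩
  (n C a) * (a C b) + (n C a) * (a C suc b) + (n C suc a) * (a C b + a C suc b)
    ≡⟨ cong (λ x → (n C a) * (a C b) + (n C a) * (a C suc b) + (n C suc a) * x)
            (nCk+nC[k+1]≡[n+1]C[k+1] a b) ⟩
  (n C a) * (a C b) + (n C a) * (a C suc b) + (n C suc a) * (suc a C suc b) ∎
  where
  open ≡-Reasoning
  expand : ∀ w x y z → (w + x) * (y + z) ≡ w * y + w * z + x * (y + z)
  expand = solve-∀

-- Trinomial coefficients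

trinomial : ℕ → ℤ → ℕ
trinomial zero    (+ zero) = 1
trinomial zero    _        = 0
trinomial (suc n) j        = trinomial n (ℤ.pred j) + trinomial n j + trinomial n (ℤ.suc j)

-- choose the j + 2k non-flat steps of a path of n steps, then the j + k of them going up
trinomialTerm : ℕ → ℕ → ℕ → ℕ
trinomialTerm n j k = (n C (j + 2 * k)) * ((j + 2 * k) C (j + k))

trinomialSum : ℕ → ℕ → ℕ
trinomialSum n j = sumTo n (trinomialTerm n j)

trinomialTerm-vanish : ∀ {n} j k → n < j + 2 * k → trinomialTerm n j k ≡ 0
trinomialTerm-vanish j k n<j+2k = cong (_* ((j + 2 * k) C (j + k))) (k>n⇒nCk≡0 n<j+2k)

trinomialSum-extend : ∀ n j → sumTo (suc n) (trinomialTerm n j) ≡ trinomialSum n j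
trinomialSum-extend n j = sumTo-extend n (trinomialTerm n j)
  (trinomialTerm-vanish j (suc n) (≤-trans (m≤n+m (suc n) (j + suc n)) (≤-reflexive (eq n j))))
  where
  eq : ∀ n j → j + suc n + suc n ≡ j + 2 * suc n
  eq = solve-∀

trinomialSum-suc-suc : ∀ n j → trinomialSum (suc n) (suc j)
                              ≡ trinomialSum n j + trinomialSum n (suc j) + trinomialSum n (suc (suc j))
trinomialSum-suc-suc n j = begin
  sumTo (suc n) (t (suc n) (suc j))
    ≡⟨ sumTo-cong (suc n) (λ k → C-pascal² n (j + 2 * k) (j + k)) ⟩
  sumTo (suc n) (λ k → t n j k + e k + t n (suc j) k)
    ≡⟨ sumTo-+ (suc n) (λ k → t n j k + e k) (t n (suc j)) ⟩
  sumTo (suc n) (λ k → t n j k + e k) + sumTo (suc n) (t n (suc j))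
    ≡⟨ cong (_+ sumTo (suc n) (t n (suc j))) (sumTo-+ (suc n) (t n j) e) ⟩
  sumTo (suc n) (t n j) + sumTo (suc n) e + sumTo (suc n) (t n (suc j))
    ≡⟨ cong₂ _+_ (cong₂ _+_ (trinomialSum-extend n j) Σe) (trinomialSum-extend n (suc j)) ⟩
  F n j + F n (suc (suc j)) + F n (suc j)
    ≡⟨ xy∙z≈xz∙y (F n j) _ _ ⟩
  F n j + F n (suc j) + F n (suc (suc j)) ∎
  where
  open ≡-Reasoning
  t : ℕ → ℕ → ℕ → ℕ
  t = trinomialTerm
  F : ℕ → ℕ → ℕ
  F = trinomialSum
  e : ℕ → ℕ
  e k = (n C (j + 2 * k)) * ((j + 2 * k) C suc (j + k))
  e[k+1]≡t : ∀ k → e (suc k) ≡ t n (suc (suc j)) k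
  e[k+1]≡t k = cong₂ (λ a b → (n C a) * (a C b)) (j+2[1+k]≡2+j+2k j k) (cong suc (+-suc j k))
  Σe : sumTo (suc n) e ≡ F n (suc (suc j))
  Σe = begin
    sumTo (suc n) e                     ≡⟨ sumTo-suc n e ⟩
    e 0 + sumTo n (λ k → e (suc k))     ≡⟨ cong₂ _+_ e0≡0 (sumTo-cong n e[k+1]≡t) ⟩
    F n (suc (suc j))                   ∎
    where
    e0≡0 : e 0 ≡ 0
    e0≡0 = trans (cong ((n C (j + 0)) *_) (k>n⇒nCk≡0 (n<1+n (j + 0)))) (*-zeroʳ (n C (j + 0)))

trinomialSum-suc-zero : ∀ n → trinomialSum (suc n) 0 ≡ trinomialSum n 1 + trinomialSum n 0 + trinomialSum n 1
trinomialSum-suc-zero n = begin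
  sumTo (suc n) (t (suc n) 0)
    ≡⟨ sumTo-suc n (t (suc n) 0) ⟩
  1 + sumTo n (λ k → t (suc n) 0 (suc k))
    ≡⟨ cong (_+_ 1) (sumTo-cong n term) ⟩
  1 + sumTo n (λ k → t n 1 k + t n 1 k + t n 0 (suc k))
    ≡⟨ cong (_+_ 1) (trans (sumTo-+ n _ _) (cong (_+ S) (sumTo-+ n (t n 1) (t n 1)))) ⟩
  1 + (F n 1 + F n 1 + S)
    ≡⟨ rearrange (F n 1) S ⟩
  F n 1 + (1 + S) + F n 1
    ≡⟨ cong (λ x → F n 1 + x + F n 1) (trans (sym (sumTo-suc n (t n 0))) (trinomialSum-extend n 0)) ⟩
  F n 1 + F n 0 + F n 1 ∎
  where
  open ≡-Reasoning
  t : ℕ → ℕ → ℕ → ℕ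
  t = trinomialTerm
  F : ℕ → ℕ → ℕ
  F = trinomialSum
  S : ℕ
  S = sumTo n (λ k → t n 0 (suc k))
  rearrange : ∀ a s → 1 + (a + a + s) ≡ a + (1 + s) + a
  rearrange = solve-∀
  term : ∀ k → t (suc n) 0 (suc k) ≡ t n 1 k + t n 1 k + t n 0 (suc k)
  term k = begin
    (suc n C 2 * suc k) * (2 * suc k C suc k)
      ≡⟨ cong (λ a → (suc n C a) * (a C suc k)) (j+2[1+k]≡2+j+2k 0 k) ⟩
    (suc n C suc a) * (suc a C suc k)
      ≡⟨ C-pascal² n a k ⟩
    (n C a) * (a C k) + t n 1 k + (n C suc a) * (suc a C suc k)
      ≡⟨ cong₂ (λ x y → (n C a) * x + t n 1 k + y) symmetric
               (cong (λ a → (n C a) * (a C suc k)) (sym (j+2[1+k]≡2+j+2k 0 k))) ⟩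
    t n 1 k + t n 1 k + t n 0 (suc k) ∎
    where
    a : ℕ
    a = suc (2 * k)
    symmetric : a C k ≡ a C suc k
    symmetric = trans (nCk≡nC[n∸k] (≤-trans (m≤m+n k (k + 0)) (n≤1+n (2 * k))))
                      (cong (a C_) (trans (cong (_∸ k) (split k)) (m+n∸m≡n k (suc k))))
      where
      split : ∀ k → suc (2 * k) ≡ k + suc k
      split = solve-∀

trinomial-sym : ∀ n j → trinomial n (ℤ.- j) ≡ trinomial n j
trinomial-sym zero    (+ zero)  = refl
trinomial-sym zero    +[1+ _ ]  = refl
trinomial-sym zero    -[1+ _ ]  = refl
trinomial-sym (suc n) j = begin
  T n (ℤ.pred (ℤ.- j)) + T n (ℤ.- j) + T n (ℤ.suc (ℤ.- j))
    ≡⟨ cong₂ (λ a b → T n a + T n (ℤ.- j) + T n b)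
             (sym (ℤP.neg-distrib-+ ℤ.1ℤ j)) (sym (ℤP.neg-distrib-+ ℤ.-1ℤ j)) ⟩
  T n (ℤ.- ℤ.suc j) + T n (ℤ.- j) + T n (ℤ.- ℤ.pred j)
    ≡⟨ cong₂ _+_ (cong₂ _+_ (trinomial-sym n (ℤ.suc j)) (trinomial-sym n j))
                 (trinomial-sym n (ℤ.pred j)) ⟩
  T n (ℤ.suc j) + T n j + T n (ℤ.pred j)
    ≡⟨ xy∙z≈zy∙x (T n (ℤ.suc j)) _ _ ⟩
  T n (ℤ.pred j) + T n j + T n (ℤ.suc j) ∎
  where
  open ≡-Reasoning
  T : ℕ → ℤ → ℕ
  T = trinomial

trinomial-vanish : ∀ n j → n < ℤ.∣ j ∣ → trinomial n j ≡ 0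
trinomial-vanish zero    (+ zero) ()
trinomial-vanish zero    +[1+ _ ] _ = refl
trinomial-vanish zero    -[1+ _ ] _ = refl
trinomial-vanish (suc n) j 1+n<∣j∣ = cong₂ _+_
  (cong₂ _+_ (trinomial-vanish n (ℤ.pred j) (shrink (ℤ.pred j) ℤ.1ℤ refl (ℤP.suc-pred j)))
             (trinomial-vanish n j (<-trans (n<1+n n) 1+n<∣j∣)))
  (trinomial-vanish n (ℤ.suc j) (shrink (ℤ.suc j) ℤ.-1ℤ refl (ℤP.pred-suc j)))
  where
  shrink : ∀ i ε → ℤ.∣ ε ∣ ≡ 1 → ε ℤ.+ i ≡ j → n < ℤ.∣ i ∣
  shrink i ε ∣ε∣≡1 ε+i≡j = ≤-pred (≤-trans 1+n<∣j∣
    (subst₂ (λ k c → ℤ.∣ k ∣ ≤ c + ℤ.∣ i ∣) ε+i≡j ∣ε∣≡1 (ℤP.∣i+j∣≤∣i∣+∣j∣ ε i)))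

trinomialSum≡trinomial : ∀ n j → trinomialSum n j ≡ trinomial n (+ j)
trinomialSum≡trinomial zero    zero    = refl
trinomialSum≡trinomial zero    (suc j) = refl
trinomialSum≡trinomial (suc n) zero    = begin
  trinomialSum (suc n) 0
    ≡⟨ trinomialSum-suc-zero n ⟩
  trinomialSum n 1 + trinomialSum n 0 + trinomialSum n 1
    ≡⟨ cong₂ _+_ (cong₂ _+_ (trans (trinomialSum≡trinomial n 1) (sym (trinomial-sym n (+ 1))))
                            (trinomialSum≡trinomial n 0))
                 (trinomialSum≡trinomial n 1) ⟩
  trinomial (suc n) (+ 0) ∎
  where open ≡-Reasoning
trinomialSum≡trinomial (suc n) (suc j) = trans (trinomialSum-suc-suc n j)
  (cong₂ _+_ (cong₂ _+_ (trinomialSum≡trinomial n j) (trinomialSum≡trinomial n (suc j)))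
             (trinomialSum≡trinomial n (suc (suc j))))

motzkin+trinomial₂≡trinomial₀ : ∀ n → motzkin n + trinomial n (+ 2) ≡ trinomial n (+ 0)
motzkin+trinomial₂≡trinomial₀ n = begin
  motzkin n + trinomial n (+ 2)
    ≡⟨ cong (_+_ (motzkin n)) (trans (sym (trinomialSum≡trinomial n 2)) (sym (Σ[2k]C[k+1] n))) ⟩
  sumTo n (λ k → (n C (2 * k)) * catalan k) + sumTo n (λ k → (n C (2 * k)) * (2 * k C suc k))
    ≡⟨ sumTo-+ n _ _ ⟨
  sumTo n (λ k → (n C (2 * k)) * catalan k + (n C (2 * k)) * (2 * k C suc k))
    ≡⟨ sumTo-cong n (λ k → trans (sym (*-distribˡ-+ (n C (2 * k)) _ _))
                                 (cong ((n C (2 * k)) *_) (catalan+[2k]C[k+1]≡[2k]Ck k))) ⟩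
  trinomialSum n 0
    ≡⟨ trinomialSum≡trinomial n 0 ⟩
  trinomial n (+ 0) ∎
  where
  open ≡-Reasoning
  Σ[2k]C[k+1] : ∀ n → sumTo n (λ k → (n C (2 * k)) * (2 * k C suc k)) ≡ trinomialSum n 2
  Σ[2k]C[k+1] zero    = refl
  Σ[2k]C[k+1] (suc n) = begin
    sumTo (suc n) (λ k → (suc n C (2 * k)) * (2 * k C suc k))
      ≡⟨ sumTo-suc n _ ⟩
    0 + sumTo n (λ k → (suc n C (2 * suc k)) * (2 * suc k C suc (suc k)))
      ≡⟨ sumTo-cong n (λ k → cong (λ a → (suc n C a) * (a C suc (suc k))) (j+2[1+k]≡2+j+2k 0 k)) ⟩
    sumTo n (trinomialTerm (suc n) 2)
      ≡⟨ sumTo-extend n (trinomialTerm (suc n) 2) (trinomialTerm-vanish 2 (suc n) (s≤s (s≤s n≤2[1+n]))) ⟨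
    trinomialSum (suc n) 2 ∎
    where
    n≤2[1+n] : n ≤ 2 * suc n
    n≤2[1+n] = ≤-trans (n≤1+n n) (m≤m+n (suc n) (suc n + 0))

-- Trinomial coefficients modulo 5

𝔽₅ : Set
𝔽₅ = Fin 5

[_] : ℕ → 𝔽₅
[ n ] = n mod 5

infixl 6 _+₅_
infixl 7 _*₅_

_+₅_ : 𝔽₅ → 𝔽₅ → 𝔽₅
x +₅ y = [ toℕ x + toℕ y ]

_*₅_ : 𝔽₅ → 𝔽₅ → 𝔽₅
x *₅ y = [ toℕ x * toℕ y ]

toℕ-[] : ∀ n → toℕ [ n ] ≡ n % 5
toℕ-[] n = toℕ-fromℕ< (m%n<n n 5)

[]-cong-% : ∀ m n → m % 5 ≡ n % 5 → [ m ] ≡ [ n ]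
[]-cong-% m n eq = fromℕ<-cong (m % 5) (n % 5) eq (m%n<n m 5) (m%n<n n 5)

[]-+ : ∀ m n → [ m + n ] ≡ [ m ] +₅ [ n ]
[]-+ m n = []-cong-% (m + n) (toℕ [ m ] + toℕ [ n ])
  (trans (%-distribˡ-+ m n 5) (sym (cong₂ (λ a b → (a + b) % 5) (toℕ-[] m) (toℕ-[] n))))

[]-* : ∀ m n → [ m * n ] ≡ [ m ] *₅ [ n ]
[]-* m n = []-cong-% (m * n) (toℕ [ m ] * toℕ [ n ])
  (trans (%-distribˡ-* m n 5) (sym (cong₂ (λ a b → (a * b) % 5) (toℕ-[] m) (toℕ-[] n))))

infix 4 _≡₅_
record _≡₅_ (m n : ℕ) : Set where
  constructor residue
  field residue-≡ : [ m ] ≡ [ n ]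
open _≡₅_

≡₅-setoid : Setoid 0ℓ 0ℓ
≡₅-setoid = record
  { Carrier       = ℕ
  ; _≈_           = _≡₅_
  ; isEquivalence = record
    { refl  = residue refl
    ; sym   = λ p → residue (sym (residue-≡ p))
    ; trans = λ p q → residue (trans (residue-≡ p) (residue-≡ q))
    }
  }

≡⇒≡₅ : ∀ {m n} → m ≡ n → m ≡₅ n
≡⇒≡₅ m≡n = residue (cong [_] m≡n)

+-cong₅ : ∀ {a a′ b b′} → a ≡₅ a′ → b ≡₅ b′ → a + b ≡₅ a′ + b′
+-cong₅ {a} {a′} {b} {b′} (residue p) (residue q) =
  residue (trans ([]-+ a b) (trans (cong₂ _+₅_ p q) (sym ([]-+ a′ b′))))

-- Frobenius: (1 + x + x⁻¹)⁵ ≡ 1 + x⁵ + x⁻⁵ (mod 5); the base case checks this coefficientwise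
trinomial-shift₅ : ∀ n j →
  trinomial (5 + n) j ≡₅ trinomial n (j ℤ.- + 5) + trinomial n j + trinomial n (j ℤ.+ + 5)
trinomial-shift₅ zero (+ 0) = residue refl
trinomial-shift₅ zero (+ 1) = residue refl
trinomial-shift₅ zero (+ 2) = residue refl
trinomial-shift₅ zero (+ 3) = residue refl
trinomial-shift₅ zero (+ 4) = residue refl
trinomial-shift₅ zero (+ 5) = residue refl
trinomial-shift₅ zero (+ suc (suc (suc (suc (suc (suc k)))))) = residue refl
trinomial-shift₅ zero -[1+ 0 ] = residue refl
trinomial-shift₅ zero -[1+ 1 ] = residue refl
trinomial-shift₅ zero -[1+ 2 ] = residue refl
trinomial-shift₅ zero -[1+ 3 ] = residue refl
trinomial-shift₅ zero -[1+ 4 ] = residue refl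
trinomial-shift₅ zero -[1+ suc (suc (suc (suc (suc k)))) ] = residue refl
trinomial-shift₅ (suc n) j = begin
  T (5 + n) j⁻ + T (5 + n) j + T (5 + n) j⁺
    ≈⟨ +-cong₅ (+-cong₅ (trinomial-shift₅ n j⁻) (trinomial-shift₅ n j)) (trinomial-shift₅ n j⁺) ⟩
  (L j⁻ + M j⁻ + R j⁻) + (L j + M j + R j) + (L j⁺ + M j⁺ + R j⁺)
    ≡⟨ transpose (L j⁻) (M j⁻) (R j⁻) (L j) (M j) (R j) (L j⁺) (M j⁺) (R j⁺) ⟩
  (L j⁻ + L j + L j⁺) + (M j⁻ + M j + M j⁺) + (R j⁻ + R j + R j⁺)
    ≡⟨ cong₂ (λ a c → a + T (suc n) j + c)
         (cong₂ (λ x y → x + L j + y) (reassoc ℤ.-1ℤ -[1+ 4 ]) (reassoc ℤ.1ℤ -[1+ 4 ]))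
         (cong₂ (λ x y → x + R j + y) (reassoc ℤ.-1ℤ (+ 5)) (reassoc ℤ.1ℤ (+ 5))) ⟩
  T (suc n) (j ℤ.- + 5) + T (suc n) j + T (suc n) (j ℤ.+ + 5) ∎
  where
  open ≈-Reasoning ≡₅-setoid
  T : ℕ → ℤ → ℕ
  T = trinomial
  j⁻ j⁺ : ℤ
  j⁻ = ℤ.pred j
  j⁺ = ℤ.suc j
  L M R : ℤ → ℕ
  L i = T n (i ℤ.- + 5)
  M i = T n i
  R i = T n (i ℤ.+ + 5)
  reassoc : ∀ ε δ → T n (ε ℤ.+ j ℤ.+ δ) ≡ T n (ε ℤ.+ (j ℤ.+ δ))
  reassoc ε δ = cong (T n) (ℤP.+-assoc ε j δ)
  transpose : ∀ a b c d e f g h i → (a + b + c) + (d + e + f) + (g + h + i)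
                                  ≡ (a + d + g) + (b + e + h) + (c + f + i)
  transpose = solve-∀

trinomial-lucas₅ : ∀ m r q s → r ≤ 4 → s ≤ 4 →
  trinomial (m * 5 + r) (+ 5 ℤ.* q ℤ.+ + s)
    ≡₅ trinomial m q * trinomial r (+ s) + trinomial m (ℤ.suc q) * trinomial r (+ s ℤ.- + 5)
trinomial-lucas₅ zero r (+ zero) s _ _ =
  ≡⇒≡₅ (sym (trans (+-identityʳ (trinomial r (+ s) + 0)) (+-identityʳ (trinomial r (+ s)))))
trinomial-lucas₅ zero r -[1+ zero ] s _ _ =
  ≡⇒≡₅ (trans (cong (trinomial r) (ℤP.+-comm -[1+ 4 ] (+ s)))
              (sym (+-identityʳ (trinomial r (+ s ℤ.- + 5)))))
trinomial-lucas₅ zero r (+[1+ q ]) s r≤4 _ =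
  ≡⇒≡₅ (trinomial-vanish r _ (≤-trans (s≤s r≤4) (≤-trans (m≤m*n 5 (suc q)) (m≤m+n (5 * suc q) s))))
trinomial-lucas₅ zero r -[1+ suc q ] s r≤4 s≤4 = ≡⇒≡₅ (trinomial-vanish r j r<∣j∣)
  where
  j : ℤ
  j = + 5 ℤ.* -[1+ suc q ] ℤ.+ + s
  10≤∣j∣+s : 10 ≤ ℤ.∣ j ∣ + s
  10≤∣j∣+s = ≤-trans (*-monoʳ-≤ 5 (s≤s (s≤s (z≤n {q}))))
    (subst₂ (λ a b → a ≤ ℤ.∣ j ∣ + b)
      (trans (cong ℤ.∣_∣ (cancel (+ 5 ℤ.* -[1+ suc q ]) (+ s))) (ℤP.abs-* (+ 5) -[1+ suc q ]))
      (ℤP.∣-i∣≡∣i∣ (+ s))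
      (ℤP.∣i+j∣≤∣i∣+∣j∣ j (ℤ.- (+ s))))
    where
    cancel : ∀ i t → i ℤ.+ t ℤ.- t ≡ i
    cancel = ℤ-Solver.solve-∀
  r<∣j∣ : r < ℤ.∣ j ∣
  r<∣j∣ = +-cancelʳ-≤ s (suc r) ℤ.∣ j ∣
    (≤-trans (+-mono-≤ (s≤s r≤4) s≤4) (≤-trans (n≤1+n 9) 10≤∣j∣+s))
trinomial-lucas₅ (suc m) r q s r≤4 s≤4 = begin
  trinomial (5 + n) j
    ≈⟨ trinomial-shift₅ n j ⟩
  T n (j ℤ.- + 5) + T n j + T n (j ℤ.+ + 5)
    ≡⟨ cong₂ (λ x y → T n x + T n j + T n y) (down q) (up q) ⟩
  T n (+ 5 ℤ.* ℤ.pred q ℤ.+ + s) + T n j + T n (+ 5 ℤ.* ℤ.suc q ℤ.+ + s)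
    ≈⟨ +-cong₅ (+-cong₅ (IH (ℤ.pred q)) (IH q)) (IH (ℤ.suc q)) ⟩
  (T m (ℤ.pred q) * A + T m (ℤ.suc (ℤ.pred q)) * B) + (T m q * A + T m (ℤ.suc q) * B)
    + (T m (ℤ.suc q) * A + T m (ℤ.suc (ℤ.suc q)) * B)
    ≡⟨ cong (λ x → (T m (ℤ.pred q) * A + T m x * B) + (T m q * A + T m (ℤ.suc q) * B)
                     + (T m (ℤ.suc q) * A + T m (ℤ.suc (ℤ.suc q)) * B)) (ℤP.suc-pred q) ⟩
  (T m (ℤ.pred q) * A + T m q * B) + (T m q * A + T m (ℤ.suc q) * B)
    + (T m (ℤ.suc q) * A + T m (ℤ.suc (ℤ.suc q)) * B)
    ≡⟨ collect (T m (ℤ.pred q)) (T m q) (T m (ℤ.suc q)) (T m (ℤ.suc (ℤ.suc q))) A B ⟩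
  (T m (ℤ.pred q) + T m q + T m (ℤ.suc q)) * A + (T m q + T m (ℤ.suc q) + T m (ℤ.suc (ℤ.suc q))) * B
    ≡⟨ cong (λ x → T (suc m) q * A + (T m x + T m (ℤ.suc q) + T m (ℤ.suc (ℤ.suc q))) * B)
            (ℤP.pred-suc q) ⟨
  T (suc m) q * A + T (suc m) (ℤ.suc q) * B ∎
  where
  open ≈-Reasoning ≡₅-setoid
  T : ℕ → ℤ → ℕ
  T = trinomial
  n : ℕ
  n = m * 5 + r
  j : ℤ
  j = + 5 ℤ.* q ℤ.+ + s
  A B : ℕ
  A = T r (+ s)
  B = T r (+ s ℤ.- + 5)
  IH : ∀ q → T n (+ 5 ℤ.* q ℤ.+ + s) ≡₅ T m q * A + T m (ℤ.suc q) * B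
  IH q = trinomial-lucas₅ m r q s r≤4 s≤4
  down : ∀ q → + 5 ℤ.* q ℤ.+ + s ℤ.- + 5 ≡ + 5 ℤ.* ℤ.pred q ℤ.+ + s
  down q = down′ q (+ s)
    where
    down′ : ∀ q t → + 5 ℤ.* q ℤ.+ t ℤ.- + 5 ≡ + 5 ℤ.* (ℤ.-1ℤ ℤ.+ q) ℤ.+ t
    down′ = ℤ-Solver.solve-∀
  up : ∀ q → + 5 ℤ.* q ℤ.+ + s ℤ.+ + 5 ≡ + 5 ℤ.* ℤ.suc q ℤ.+ + s
  up q = up′ q (+ s)
    where
    up′ : ∀ q t → + 5 ℤ.* q ℤ.+ t ℤ.+ + 5 ≡ + 5 ℤ.* (ℤ.1ℤ ℤ.+ q) ℤ.+ t
    up′ = ℤ-Solver.solve-∀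
  collect : ∀ a b c d x y → (a * x + b * y) + (b * x + c * y) + (c * x + d * y)
                          ≡ (a + b + c) * x + (b + c + d) * y
  collect = solve-∀

-- The base-5 digit automaton

T₀ T₁ T₂ : ℕ → 𝔽₅
T₀ n = [ trinomial n (+ 0) ]
T₁ n = [ trinomial n (+ 1) ]
T₂ n = [ trinomial n (+ 2) ]

digitCoeff : Fin 5 → 𝔽₅ → 𝔽₅ → ℕ → 𝔽₅
digitCoeff r x y s = x *₅ [ trinomial (toℕ r) (+ s) ] +₅ y *₅ [ trinomial (toℕ r) (+ s ℤ.- + 5) ]

trinomial-digit : ∀ m (r : Fin 5) s → s ≤ 4 →
                  [ trinomial (toℕ r + m * 5) (+ s) ] ≡ digitCoeff r (T₀ m) (T₁ m) s
trinomial-digit m r s s≤4 = begin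
  [ trinomial (toℕ r + m * 5) (+ s) ]
    ≡⟨ cong (λ n → [ trinomial n (+ s) ]) (+-comm (toℕ r) (m * 5)) ⟩
  [ trinomial (m * 5 + toℕ r) (+ s) ]
    ≡⟨ residue-≡ (trinomial-lucas₅ m (toℕ r) (+ 0) s (toℕ≤pred[n] r) s≤4) ⟩
  [ trinomial m (+ 0) * a + trinomial m (+ 1) * b ]
    ≡⟨ trans ([]-+ (trinomial m (+ 0) * a) _)
             (cong₂ _+₅_ ([]-* (trinomial m (+ 0)) a) ([]-* (trinomial m (+ 1)) b)) ⟩
  digitCoeff r (T₀ m) (T₁ m) s ∎
  where
  open ≡-Reasoning
  a b : ℕ
  a = trinomial (toℕ r) (+ s)
  b = trinomial (toℕ r) (+ s ℤ.- + 5)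

-- Fermat: x ⁻¹ = x³ is the inverse of every x ≢ 0 in 𝔽₅
_⁻¹ : 𝔽₅ → 𝔽₅
x ⁻¹ = x *₅ x *₅ x

σ : 𝔽₅ → 𝔽₅
σ t = 4F +₅ 4F *₅ t

σ-preserves-≢2 : ∀ s → s ≢ 2F → σ s ≢ 2F
σ-preserves-≢2 = from-yes (all? λ s → ¬? (s ≟₅ 2F) →-dec ¬? (σ s ≟₅ 2F))

ρ-step : 𝔽₅ → Fin 5 → 𝔽₅
ρ-step _ 0F = 0F
ρ-step _ 1F = 1F
ρ-step _ 2F = 4F
ρ-step _ 3F = 3F
ρ-step t 4F = σ t

zero-step : 𝔽₅ → Fin 5 → Bool
zero-step t 3F = does (t ≟₅ 4F)
zero-step t 4F = does (t ≟₅ 1F)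
zero-step _ _  = false

digitCoeff₀≢0 : ∀ r x y → x ≢ 0F → digitCoeff r x y 0 ≢ 0F
digitCoeff₀≢0 = from-yes (all? λ r → all? λ x → all? λ y →
  ¬? (x ≟₅ 0F) →-dec ¬? (digitCoeff r x y 0 ≟₅ 0F))

digitCoeff-ratio : ∀ r x y → x ≢ 0F →
                   digitCoeff r x y 1 *₅ digitCoeff r x y 0 ⁻¹ ≡ ρ-step (y *₅ x ⁻¹) r
digitCoeff-ratio = from-yes (all? λ r → all? λ x → all? λ y →
  ¬? (x ≟₅ 0F) →-dec (digitCoeff r x y 1 *₅ digitCoeff r x y 0 ⁻¹ ≟₅ ρ-step (y *₅ x ⁻¹) r))

digitCoeff-zero : ∀ r x y → x ≢ 0F →
                  does (digitCoeff r x y 0 ≟₅ digitCoeff r x y 2) ≡ zero-step (y *₅ x ⁻¹) r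
digitCoeff-zero = from-yes (all? λ r → all? λ x → all? λ y →
  ¬? (x ≟₅ 0F) →-dec
  (does (digitCoeff r x y 0 ≟₅ digitCoeff r x y 2) Bool.≟ zero-step (y *₅ x ⁻¹) r))

[n]+[n/5]*5≡n : ∀ n → toℕ [ n ] + n / 5 * 5 ≡ n
[n]+[n/5]*5≡n n = trans (cong (_+ n / 5 * 5) (toℕ-[] n)) (sym (m≡m%n+[m/n]*n n 5))

digit-induction : (P : ℕ → Set) → P 0 → (∀ m (r : Fin 5) → P m → P (toℕ r + m * 5)) → ∀ n → P n
digit-induction P P0 step = <-rec P go
  where
  go : ∀ n → (∀ {m} → m < n → P m) → P n
  go zero    _   = P0
  go (suc n) rec = subst P ([n]+[n/5]*5≡n (suc n))
    (step (suc n / 5) [ suc n ] (rec (m/n<m (suc n) 5 (s≤s (s≤s z≤n)))))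

T₀≢0 : ∀ n → T₀ n ≢ 0F
T₀≢0 = digit-induction (λ n → T₀ n ≢ 0F) (λ ()) λ m r T₀m≢0 →
  subst (_≢ 0F) (sym (trinomial-digit m r 0 z≤n)) (digitCoeff₀≢0 r (T₀ m) (T₁ m) T₀m≢0)

ρ : ℕ → 𝔽₅
ρ n = T₁ n *₅ T₀ n ⁻¹

ρ-digit : ∀ m r → ρ (toℕ r + m * 5) ≡ ρ-step (ρ m) r
ρ-digit m r = begin
  T₁ (toℕ r + m * 5) *₅ T₀ (toℕ r + m * 5) ⁻¹
    ≡⟨ cong₂ (λ y x → y *₅ x ⁻¹) (trinomial-digit m r 1 (s≤s z≤n)) (trinomial-digit m r 0 z≤n) ⟩
  digitCoeff r (T₀ m) (T₁ m) 1 *₅ digitCoeff r (T₀ m) (T₁ m) 0 ⁻¹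
    ≡⟨ digitCoeff-ratio r (T₀ m) (T₁ m) (T₀≢0 m) ⟩
  ρ-step (ρ m) r ∎
  where open ≡-Reasoning

motzkin≡0-mod5⇔T₀≡T₂ : ∀ n → does (motzkin n % 5 ≟ 0) ≡ does (T₀ n ≟₅ T₂ n)
motzkin≡0-mod5⇔T₀≡T₂ n = begin
  does (motzkin n % 5 ≟ 0)           ≡⟨ cong (λ k → does (k ≟ 0)) (toℕ-[] (motzkin n)) ⟨
  does (toℕ [ motzkin n ] ≟ 0)       ≡⟨ zero⇔+-cancel [ motzkin n ] (T₂ n) ⟩
  does ([ motzkin n ] +₅ T₂ n ≟₅ T₂ n) ≡⟨ cong (λ x → does (x ≟₅ T₂ n)) [M]+T₂≡T₀ ⟩
  does (T₀ n ≟₅ T₂ n)                ∎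
  where
  open ≡-Reasoning
  [M]+T₂≡T₀ : [ motzkin n ] +₅ T₂ n ≡ T₀ n
  [M]+T₂≡T₀ = trans (sym ([]-+ (motzkin n) _)) (cong [_] (motzkin+trinomial₂≡trinomial₀ n))
  zero⇔+-cancel : ∀ a b → does (toℕ a ≟ 0) ≡ does (a +₅ b ≟₅ b)
  zero⇔+-cancel = from-yes (all? λ a → all? λ b → does (toℕ a ≟ 0) Bool.≟ does (a +₅ b ≟₅ b))

motzkin≡0-mod5-digit : ∀ m r → does (motzkin (toℕ r + m * 5) % 5 ≟ 0) ≡ zero-step (ρ m) r
motzkin≡0-mod5-digit m r = begin
  does (motzkin (toℕ r + m * 5) % 5 ≟ 0)
    ≡⟨ motzkin≡0-mod5⇔T₀≡T₂ (toℕ r + m * 5) ⟩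
  does (T₀ (toℕ r + m * 5) ≟₅ T₂ (toℕ r + m * 5))
    ≡⟨ cong₂ (λ x z → does (x ≟₅ z)) (trinomial-digit m r 0 z≤n)
                                     (trinomial-digit m r 2 (s≤s (s≤s z≤n))) ⟩
  does (digitCoeff r (T₀ m) (T₁ m) 0 ≟₅ digitCoeff r (T₀ m) (T₁ m) 2)
    ≡⟨ digitCoeff-zero r (T₀ m) (T₁ m) (T₀≢0 m) ⟩
  zero-step (ρ m) r ∎
  where open ≡-Reasoning

-- Counting

𝟙 : Bool → ℕ
𝟙 b = if b then 1 else 0

countBelow : (ℕ → Bool) → ℕ → ℕ
countBelow p zero    = 0
countBelow p (suc N) = countBelow p N + 𝟙 (p N)

countUpTo≡countBelow : ∀ {ℓ} {A : Pred ℕ ℓ} (A? : Decidable A) N →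
                       countUpTo A? N ≡ countBelow (λ n → does (A? n)) (suc N)
countUpTo≡countBelow A? zero    = refl
countUpTo≡countBelow A? (suc N) = cong (_+ 𝟙 (does (A? (suc N)))) (countUpTo≡countBelow A? N)

countBelow-mono : ∀ p {M N} → M ≤ N → countBelow p M ≤ countBelow p N
countBelow-mono p {M} M≤N = go (≤⇒≤′ M≤N)
  where
  go : ∀ {N} → M ≤′ N → countBelow p M ≤ countBelow p N
  go ≤′-refl                = ≤-refl
  go (≤′-step {N} M≤′N) = ≤-trans (go M≤′N) (m≤m+n (countBelow p N) _)

blockSum : (Fin 5 → Bool) → ℕ
blockSum f = 𝟙 (f 0F) + 𝟙 (f 1F) + 𝟙 (f 2F) + 𝟙 (f 3F) + 𝟙 (f 4F)

blockSum-cong : ∀ {f g} → (∀ r → f r ≡ g r) → blockSum f ≡ blockSum g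
blockSum-cong {f} {g} f≗g = cong₂ _+_ (cong₂ _+_ (cong₂ _+_ (cong₂ _+_ (c 0F) (c 1F)) (c 2F)) (c 3F)) (c 4F)
  where
  c : ∀ r → 𝟙 (f r) ≡ 𝟙 (g r)
  c r = cong 𝟙 (f≗g r)

countBelow-block : ∀ p M {f} → (∀ r → p (toℕ r + M * 5) ≡ f r) →
                   countBelow p (suc M * 5) ≡ countBelow p (M * 5) + blockSum f
countBelow-block p M {f} p≗f = begin
  countBelow p (M * 5) + 𝟙 (p (M * 5)) + 𝟙 (p (1 + M * 5)) + 𝟙 (p (2 + M * 5))
                       + 𝟙 (p (3 + M * 5)) + 𝟙 (p (4 + M * 5))
    ≡⟨ reassoc (countBelow p (M * 5)) _ _ _ _ _ ⟩
  countBelow p (M * 5) + blockSum (λ r → p (toℕ r + M * 5))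
    ≡⟨ cong (_+_ (countBelow p (M * 5))) (blockSum-cong p≗f) ⟩
  countBelow p (M * 5) + blockSum f ∎
  where
  open ≡-Reasoning
  reassoc : ∀ c a b d e g → c + a + b + d + e + g ≡ c + (a + b + d + e + g)
  reassoc = solve-∀

ρ-count : 𝔽₅ → ℕ → ℕ
ρ-count s = countBelow (λ n → does (ρ n ≟₅ s))

ρ-count-block : ∀ s → s ≢ 2F → ∀ M → ρ-count s (M * 5) ≡ M + ρ-count (σ s) M
ρ-count-block s s≢2F zero    = refl
ρ-count-block s s≢2F (suc M) = begin
  ρ-count s (suc M * 5)
    ≡⟨ countBelow-block _ M (λ r → cong (λ t → does (t ≟₅ s)) (ρ-digit M r)) ⟩
  ρ-count s (M * 5) + blockSum (λ r → does (ρ-step (ρ M) r ≟₅ s))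
    ≡⟨ cong₂ _+_ (ρ-count-block s s≢2F M) (block-hits (ρ M) s s≢2F) ⟩
  M + ρ-count (σ s) M + (1 + 𝟙 (does (ρ M ≟₅ σ s)))
    ≡⟨ rearrange M (ρ-count (σ s) M) _ ⟩
  suc M + ρ-count (σ s) (suc M) ∎
  where
  open ≡-Reasoning
  -- ρ-step t hits each s ≢ 2 exactly once on the digits 0–3, and σ is an involution
  block-hits : ∀ t s → s ≢ 2F →
               blockSum (λ r → does (ρ-step t r ≟₅ s)) ≡ 1 + 𝟙 (does (t ≟₅ σ s))
  block-hits = from-yes (all? λ t → all? λ s → ¬? (s ≟₅ 2F) →-dec
                 (blockSum (λ r → does (ρ-step t r ≟₅ s)) ≟ 1 + 𝟙 (does (t ≟₅ σ s))))
  rearrange : ∀ m c i → m + c + (1 + i) ≡ suc m + (c + i)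
  rearrange = solve-∀

zero-count : ℕ → ℕ
zero-count = countBelow (λ n → does (motzkin n % 5 ≟ 0))

zero-count-block : ∀ M → zero-count (M * 5) ≡ ρ-count 4F M + ρ-count 1F M
zero-count-block zero    = refl
zero-count-block (suc M) = begin
  zero-count (suc M * 5)
    ≡⟨ countBelow-block _ M (motzkin≡0-mod5-digit M) ⟩
  zero-count (M * 5) + (𝟙 (does (ρ M ≟₅ 4F)) + 𝟙 (does (ρ M ≟₅ 1F)))
    ≡⟨ cong (_+ (𝟙 (does (ρ M ≟₅ 4F)) + 𝟙 (does (ρ M ≟₅ 1F)))) (zero-count-block M) ⟩
  ρ-count 4F M + ρ-count 1F M + (𝟙 (does (ρ M ≟₅ 4F)) + 𝟙 (does (ρ M ≟₅ 1F)))
    ≡⟨ interchange (ρ-count 4F M) _ _ _ ⟩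
  ρ-count 4F (suc M) + ρ-count 1F (suc M) ∎
  where open ≡-Reasoning

∣-∣-+ : ∀ a b c d → ∣ a + b - (c + d) ∣ ≤ ∣ a - c ∣ + ∣ b - d ∣
∣-∣-+ a b c d = begin
  ∣ a + b - (c + d) ∣                     ≤⟨ ∣-∣-triangle (a + b) (c + b) (c + d) ⟩
  ∣ a + b - (c + b) ∣ + ∣ c + b - (c + d) ∣ ≡⟨ cong₂ _+_ right-cancel (∣m+n-m+o∣≡∣n-o∣ c b d) ⟩
  ∣ a - c ∣ + ∣ b - d ∣                   ∎
  where
  open ≤-Reasoning
  right-cancel : ∣ a + b - (c + b) ∣ ≡ ∣ a - c ∣
  right-cancel = trans (cong₂ ∣_-_∣ (+-comm a b) (+-comm c b)) (∣m+n-m+o∣≡∣n-o∣ b a c)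

∣m-[n+o]∣≤∣m-n∣+o : ∀ m n o → ∣ m - (n + o) ∣ ≤ ∣ m - n ∣ + o
∣m-[n+o]∣≤∣m-n∣+o m n o =
  ≤-trans (∣-∣-triangle m n (n + o)) (≤-reflexive (cong (_+_ ∣ m - n ∣) (∣m-m+n∣≡n n o)))

∣countBelow[k+N]-countBelow[N]∣≤k : ∀ p k N → ∣ countBelow p (k + N) - countBelow p N ∣ ≤ k
∣countBelow[k+N]-countBelow[N]∣≤k p k N =
  subst (_≤ k) (sym (m≤n⇒∣n-m∣≡n∸m (countBelow-mono p (m≤n+m N k))))
    (m≤n+o⇒m∸n≤o _ _ (upper k))
  where
  𝟙≤1 : ∀ b → 𝟙 b ≤ 1
  𝟙≤1 true  = ≤-refl
  𝟙≤1 false = z≤n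
  upper : ∀ k → countBelow p (k + N) ≤ countBelow p N + k
  upper zero    = ≤-reflexive (sym (+-identityʳ _))
  upper (suc k) = ≤-trans (+-mono-≤ (upper k) (𝟙≤1 (p (k + N))))
    (≤-reflexive (trans (+-assoc (countBelow p N) k 1) (cong (_+_ (countBelow p N)) (+-comm k 1))))

N/5<5^k : ∀ {N} k → N < 5 ^ suc k → N / 5 < 5 ^ k
N/5<5^k {N} k N<5^[1+k] = m<n*o⇒m/o<n (subst (N <_) (*-comm 5 (5 ^ k)) N<5^[1+k])

ρ-count-bound : ∀ k s → s ≢ 2F → ∀ N → N < 5 ^ k → ∣ 4 * ρ-count s N - N ∣ ≤ 20 * k
ρ-count-bound zero    _ _ zero    _ = z≤n
ρ-count-bound zero    _ _ (suc N) (s≤s ())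
ρ-count-bound (suc k) s s≢2F N N<5^[1+k] =
  subst (λ N → ∣ 4 * ρ-count s N - N ∣ ≤ 20 * suc k) ([n]+[n/5]*5≡n N) (begin
    ∣ 4 * c - N′ ∣                    ≤⟨ ∣-∣-triangle (4 * c) (4 * A) N′ ⟩
    ∣ 4 * c - 4 * A ∣ + ∣ 4 * A - N′ ∣ ≡⟨ cong (_+ ∣ 4 * A - N′ ∣) (*-distribˡ-∣-∣ 4 c A) ⟨
    4 * ∣ c - A ∣ + ∣ 4 * A - N′ ∣     ≤⟨ +-mono-≤ (*-monoʳ-≤ 4 c≈A) A≈N′ ⟩
    4 * r + (20 * k + r)              ≡⟨ collect k r ⟩
    20 * k + 5 * r                    ≤⟨ +-monoʳ-≤ (20 * k) (*-monoʳ-≤ 5 r≤4) ⟩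
    20 * k + 5 * 4                    ≡⟨ trans (+-comm (20 * k) 20) (sym (*-suc 20 k)) ⟩
    20 * suc k                        ∎)
  where
  open ≤-Reasoning
  r : ℕ
  r = toℕ [ N ]
  r≤4 : r ≤ 4
  r≤4 = toℕ≤pred[n] [ N ]
  M N′ c A c′ : ℕ
  M = N / 5
  N′ = r + M * 5
  c = ρ-count s N′
  A = ρ-count s (M * 5)
  c′ = ρ-count (σ s) M
  c≈A : ∣ c - A ∣ ≤ r
  c≈A = ∣countBelow[k+N]-countBelow[N]∣≤k _ r (M * 5)
  A≈N′ : ∣ 4 * A - N′ ∣ ≤ 20 * k + r
  A≈N′ = begin
    ∣ 4 * A - N′ ∣                      ≡⟨ cong₂ ∣_-_∣ 4A≡ (split r M) ⟩
    ∣ 4 * M + 4 * c′ - (4 * M + M + r) ∣ ≤⟨ ∣m-[n+o]∣≤∣m-n∣+o (4 * M + 4 * c′) (4 * M + M) r ⟩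
    ∣ 4 * M + 4 * c′ - (4 * M + M) ∣ + r ≡⟨ cong (_+ r) (∣m+n-m+o∣≡∣n-o∣ (4 * M) (4 * c′) M) ⟩
    ∣ 4 * c′ - M ∣ + r                  ≤⟨ +-monoˡ-≤ r c′≈M ⟩
    20 * k + r                          ∎
    where
    4A≡ : 4 * A ≡ 4 * M + 4 * c′
    4A≡ = trans (cong (4 *_) (ρ-count-block s s≢2F M)) (*-distribˡ-+ 4 M c′)
    split : ∀ r M → r + M * 5 ≡ 4 * M + M + r
    split = solve-∀
    c′≈M : ∣ 4 * c′ - M ∣ ≤ 20 * k
    c′≈M = ρ-count-bound k (σ s) (σ-preserves-≢2 s s≢2F) M (N/5<5^k k N<5^[1+k])
  collect : ∀ k r → 4 * r + (20 * k + r) ≡ 20 * k + 5 * r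
  collect = solve-∀

zero-count-bound : ∀ k N → N < 5 ^ k → ∣ 10 * zero-count N - N ∣ ≤ 100 * k
zero-count-bound zero    zero    _ = z≤n
zero-count-bound zero    (suc N) (s≤s ())
zero-count-bound (suc k) N N<5^[1+k] =
  subst (λ N → ∣ 10 * zero-count N - N ∣ ≤ 100 * suc k) ([n]+[n/5]*5≡n N) (*-cancelˡ-≤ 2 (begin
    2 * ∣ 10 * Z - N′ ∣                               ≡⟨ *-distribˡ-∣-∣ 2 (10 * Z) N′ ⟩
    ∣ 2 * (10 * Z) - 2 * N′ ∣                          ≤⟨ ∣-∣-triangle (2 * (10 * Z)) (20 * B) (2 * N′) ⟩
    ∣ 2 * (10 * Z) - 20 * B ∣ + ∣ 20 * B - 2 * N′ ∣    ≤⟨ +-mono-≤ Z≈B B≈N′ ⟩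
    20 * r + (200 * k + 2 * r)                        ≡⟨ collect k r ⟩
    200 * k + 22 * r                                  ≤⟨ +-monoʳ-≤ (200 * k) (*-monoʳ-≤ 22 r≤4) ⟩
    200 * k + 22 * 4                                  ≤⟨ +-monoʳ-≤ (200 * k) (m≤m+n 88 112) ⟩
    200 * k + 200                                     ≡⟨ top k ⟩
    2 * (100 * suc k)                                 ∎))
  where
  open ≤-Reasoning
  r : ℕ
  r = toℕ [ N ]
  r≤4 : r ≤ 4
  r≤4 = toℕ≤pred[n] [ N ]
  M N′ Z B c₄ c₁ : ℕ
  M = N / 5
  N′ = r + M * 5
  Z = zero-count N′
  B = zero-count (M * 5)
  c₄ = ρ-count 4F M
  c₁ = ρ-count 1F M
  M<5^k : M < 5 ^ k
  M<5^k = N/5<5^k k N<5^[1+k]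
  Z≈B : ∣ 2 * (10 * Z) - 20 * B ∣ ≤ 20 * r
  Z≈B = begin
    ∣ 2 * (10 * Z) - 20 * B ∣ ≡⟨ cong (λ x → ∣ x - 20 * B ∣) (sym (*-assoc 2 10 Z)) ⟩
    ∣ 20 * Z - 20 * B ∣       ≡⟨ *-distribˡ-∣-∣ 20 Z B ⟨
    20 * ∣ Z - B ∣            ≤⟨ *-monoʳ-≤ 20 (∣countBelow[k+N]-countBelow[N]∣≤k _ r (M * 5)) ⟩
    20 * r                    ∎
  B≈N′ : ∣ 20 * B - 2 * N′ ∣ ≤ 200 * k + 2 * r
  B≈N′ = begin
    ∣ 20 * B - 2 * N′ ∣                             ≡⟨ cong₂ ∣_-_∣ 20B≡ (split r M) ⟩
    ∣ 5 * c - (5 * (M + M) + 2 * r) ∣                 ≤⟨ ∣m-[n+o]∣≤∣m-n∣+o (5 * c) _ (2 * r) ⟩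
    ∣ 5 * c - 5 * (M + M) ∣ + 2 * r                   ≡⟨ cong (_+ 2 * r) (*-distribˡ-∣-∣ 5 c (M + M)) ⟨
    5 * ∣ c - (M + M) ∣ + 2 * r                      ≤⟨ +-monoˡ-≤ (2 * r) (*-monoʳ-≤ 5 c≈2M) ⟩
    5 * (20 * k + 20 * k) + 2 * r                   ≡⟨ cong (_+ 2 * r) (double k) ⟩
    200 * k + 2 * r                                 ∎
    where
    c : ℕ
    c = 4 * c₄ + 4 * c₁
    20B≡ : 20 * B ≡ 5 * c
    20B≡ = trans (cong (20 *_) (zero-count-block M)) (distrib c₄ c₁)
      where
      distrib : ∀ a b → 20 * (a + b) ≡ 5 * (4 * a + 4 * b)
      distrib = solve-∀
    split : ∀ r M → 2 * (r + M * 5) ≡ 5 * (M + M) + 2 * r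
    split = solve-∀
    c≈2M : ∣ c - (M + M) ∣ ≤ 20 * k + 20 * k
    c≈2M = ≤-trans (∣-∣-+ (4 * c₄) (4 * c₁) M M)
      (+-mono-≤ (ρ-count-bound k 4F (λ ()) M M<5^k) (ρ-count-bound k 1F (λ ()) M M<5^k))
    double : ∀ k → 5 * (20 * k + 20 * k) ≡ 200 * k
    double = solve-∀
  collect : ∀ k r → 20 * r + (200 * k + 2 * r) ≡ 200 * k + 22 * r
  collect = solve-∀
  top : ∀ k → 200 * k + 200 ≡ 2 * (100 * suc k)
  top = solve-∀

-- Density

∣m⊖n∣≡∣m-n∣ : ∀ m n → ℤ.∣ m ⊖ n ∣ ≡ ∣ m - n ∣
∣m⊖n∣≡∣m-n∣ m n with ≤-total m n
... | inj₁ m≤n = trans (ℤP.∣⊖∣-≤ m≤n) (sym (m≤n⇒∣m-n∣≡n∸m m≤n))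
... | inj₂ n≤m =
  trans (ℤP.∣m⊖n∣≡∣n⊖m∣ m n) (trans (ℤP.∣⊖∣-≤ n≤m) (sym (m≤n⇒∣n-m∣≡n∸m n≤m)))

∣m/[1+n]-1/[1+d]∣<ε : ∀ m n d p q .{c : Coprime (suc p) (suc q)} →
  ∣ m * suc d - suc n ∣ * suc q < suc p * (suc n * suc d) →
  ℚ.∣ ratio m (suc n) ℚ.- (+ 1) /ℚ suc d ∣ ℚ.< mkℚ (+ suc p) q c
∣m/[1+n]-1/[1+d]∣<ε m n d p q close =
  ℚP.toℚᵘ-cancel-< (ℚᵘP.<-respˡ-≃ (ℚᵘP.≃-sym toℚᵘ-lhs) (ℚᵘ.*<* ℤ-close))
  where
  a b : ℚ
  a = (+ m) /ℚ suc n
  b = (+ 1) /ℚ suc d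
  toℚᵘ-lhs : ℚ.toℚᵘ ℚ.∣ a ℚ.- b ∣ ℚᵘ.≃ ℚᵘ.∣ ℚᵘ.mkℚᵘ (+ m) n ℚᵘ.- ℚᵘ.mkℚᵘ (+ 1) d ∣
  toℚᵘ-lhs = ℚᵘP.≃-trans (ℚP.toℚᵘ-homo-∣-∣ (a ℚ.- b))
    (ℚᵘP.∣-∣-cong (ℚᵘP.≃-trans (ℚP.toℚᵘ-homo-+ a (ℚ.- b))
      (ℚᵘP.+-cong (ℚP.toℚᵘ-fromℚᵘ (ℚᵘ.mkℚᵘ (+ m) n))
        (ℚᵘP.≃-trans (ℚP.toℚᵘ-homo‿- b) (ℚᵘP.-‿cong (ℚP.toℚᵘ-fromℚᵘ (ℚᵘ.mkℚᵘ (+ 1) d)))))))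
  num : ℤ
  num = + m ℤ.* + suc d ℤ.+ ℤ.- (+ 1) ℤ.* + suc n
  num≡ : num ≡ m * suc d ⊖ suc n
  num≡ = trans (cong₂ ℤ._+_ (sym (ℤP.pos-* m (suc d))) (ℤP.-1*i≡-i (+ suc n)))
               (ℤP.m-n≡m⊖n (m * suc d) (suc n))
  ℤ-close : + ℤ.∣ num ∣ ℤ.* + suc q ℤ.< + suc p ℤ.* + (suc n * suc d)
  ℤ-close = subst₂ ℤ._<_
    (trans (cong (λ i → + (ℤ.∣ i ∣ * suc q)) (sym num≡)) (ℤP.pos-* ℤ.∣ num ∣ (suc q)))
    (ℤP.pos-* (suc p) (suc n * suc d))
    (ℤ.+<+ (subst (λ e → e * suc q < _) (sym (∣m⊖n∣≡∣m-n∣ (m * suc d) (suc n))) close))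

5^k≤1+n<5^[1+k] : ∀ n → ∃[ k ] 5 ^ k ≤ suc n × suc n < 5 ^ suc k
5^k≤1+n<5^[1+k] zero = 0 , s≤s z≤n , s≤s (s≤s z≤n)
5^k≤1+n<5^[1+k] (suc n) with 5^k≤1+n<5^[1+k] n
... | k , 5^k≤1+n , 1+n<5^[1+k] with suc (suc n) <? 5 ^ suc k
...   | yes 2+n<5^[1+k] = k , m≤n⇒m≤1+n 5^k≤1+n , 2+n<5^[1+k]
...   | no  2+n≮5^[1+k] = suc k , ≤-reflexive (sym 2+n≡5^[1+k]) ,
          subst (_< 5 ^ suc (suc k)) (sym 2+n≡5^[1+k]) (^-monoʳ-< 5 (s≤s (s≤s z≤n)) (n<1+n (suc k)))
  where
  2+n≡5^[1+k] : suc (suc n) ≡ 5 ^ suc k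
  2+n≡5^[1+k] = ≤-antisym 1+n<5^[1+k] (≮⇒≥ 2+n≮5^[1+k])

[1+k]²≤5^k : ∀ k → suc k * suc k ≤ 5 ^ k
[1+k]²≤5^k zero    = ≤-refl
[1+k]²≤5^k (suc k) = begin
  suc (suc k) * suc (suc k)                                 ≤⟨ m≤m+n _ (4 * k * k + 6 * k + 1) ⟩
  suc (suc k) * suc (suc k) + (4 * k * k + 6 * k + 1)       ≡⟨ expand k ⟩
  5 * (suc k * suc k)                                       ≤⟨ *-monoʳ-≤ 5 ([1+k]²≤5^k k) ⟩
  5 ^ suc k                                                 ∎
  where
  open ≤-Reasoning
  expand : ∀ k → suc (suc k) * suc (suc k) + (4 * k * k + 6 * k + 1) ≡ 5 * (suc k * suc k)
  expand = solve-∀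

^-cancelʳ-< : ∀ m .{{_ : NonZero m}} {a b} → m ^ a < m ^ b → a < b
^-cancelʳ-< m {a} {b} m^a<m^b with a <? b
... | yes a<b = a<b
... | no  a≮b = contradiction (^-monoʳ-≤ m (≮⇒≥ a≮b)) (<⇒≱ m^a<m^b)

∣1+n-n∣≡1 : ∀ n → ∣ suc n - n ∣ ≡ 1
∣1+n-n∣≡1 zero    = refl
∣1+n-n∣≡1 (suc n) = ∣1+n-n∣≡1 n

[c[1+k]+1][1+q]+2≤[1+k]² : ∀ c q k → 2 + suc c * suc q ≤ suc k →
                           (c * suc k + 1) * suc q + 2 ≤ suc k * suc k
[c[1+k]+1][1+q]+2≤[1+k]² c q k 2+X≤1+k = begin
  (c * suc k + 1) * suc q + 2                                 ≤⟨ m≤m+n _ (k * suc q + 2 * k) ⟩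
  (c * suc k + 1) * suc q + 2 + (k * suc q + 2 * k)           ≡⟨ expand c q k ⟩
  suc k * (2 + suc c * suc q)                                 ≤⟨ *-monoʳ-≤ (suc k) 2+X≤1+k ⟩
  suc k * suc k                                               ∎
  where
  open ≤-Reasoning
  expand : ∀ c q k → (c * suc k + 1) * suc q + 2 + (k * suc q + 2 * k)
                   ≡ suc k * (2 + suc c * suc q)
  expand = solve-∀

hasDensity-from-log-error : ∀ {ℓ} {A : Pred ℕ ℓ} (A? : Decidable A) d c →
  (∀ k N → N < 5 ^ k → ∣ suc d * countBelow (λ n → does (A? n)) N - N ∣ ≤ c * k) →
  HasDensity A? ((+ 1) /ℚ suc d)
hasDensity-from-log-error A? d c bound (mkℚ (+ zero) _ _)   (ℚ.*<* (ℤ.+<+ ()))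
hasDensity-from-log-error A? d c bound (mkℚ -[1+ _ ] _ _)   (ℚ.*<* ())
hasDensity-from-log-error A? d c bound ε@(mkℚ (+ suc p) q _) _ = 5 ^ suc X , close
  where
  -- with 5ᵏ ≤ N + 1 < 5ᵏ⁺¹ the error is at most c (k + 1) + 1, and (k + 1)² ≤ N + 1;
  -- N ≥ 5ˣ⁺¹ forces k > X, which makes the relative error smaller than 1 / (q + 1)
  X : ℕ
  X = suc c * suc q
  close : ∀ N → 5 ^ suc X ≤ N → ℚ.∣ ratio (countUpTo A? N) N ℚ.- (+ 1) /ℚ suc d ∣ ℚ.< ε
  close zero    5^[1+X]≤0 = contradiction 5^[1+X]≤0 (<⇒≱ (m^n>0 5 (suc X)))
  close (suc n) 5^[1+X]≤1+n with 5^k≤1+n<5^[1+k] (suc n)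
  ... | k , 5^k≤2+n , 2+n<5^[1+k] = ∣m/[1+n]-1/[1+d]∣<ε m n d p q (begin-strict
    ∣ m * suc d - suc n ∣ * suc q ≤⟨ *-monoˡ-≤ (suc q) error ⟩
    (c * suc k + 1) * suc q       <⟨ small ⟩
    suc n                         ≤⟨ m≤m*n (suc n) (suc d) ⟩
    suc n * suc d                 ≤⟨ m≤n*m (suc n * suc d) (suc p) ⟩
    suc p * (suc n * suc d)       ∎)
    where
    open ≤-Reasoning
    m : ℕ
    m = countUpTo A? (suc n)
    error : ∣ m * suc d - suc n ∣ ≤ c * suc k + 1
    error = begin
      ∣ m * suc d - suc n ∣
        ≤⟨ ∣-∣-triangle (m * suc d) (suc (suc n)) (suc n) ⟩
      ∣ m * suc d - suc (suc n) ∣ + ∣ suc (suc n) - suc n ∣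
        ≡⟨ cong₂ (λ x y → ∣ x - suc (suc n) ∣ + y) m[1+d]≡ (∣1+n-n∣≡1 n) ⟩
      ∣ suc d * countBelow _ (suc (suc n)) - suc (suc n) ∣ + 1
        ≤⟨ +-monoˡ-≤ 1 (bound (suc k) (suc (suc n)) 2+n<5^[1+k]) ⟩
      c * suc k + 1 ∎
      where
      m[1+d]≡ : m * suc d ≡ suc d * countBelow (λ i → does (A? i)) (suc (suc n))
      m[1+d]≡ = trans (*-comm m (suc d)) (cong (suc d *_) (countUpTo≡countBelow A? (suc n)))
    2+X≤1+k : 2 + X ≤ suc k
    2+X≤1+k = ^-cancelʳ-< 5 (<-trans (s≤s 5^[1+X]≤1+n) 2+n<5^[1+k])
    small : (c * suc k + 1) * suc q < suc n
    small = s≤s (+-cancelʳ-≤ 2 _ n (begin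
      (c * suc k + 1) * suc q + 2 ≤⟨ [c[1+k]+1][1+q]+2≤[1+k]² c q k 2+X≤1+k ⟩
      suc k * suc k               ≤⟨ [1+k]²≤5^k k ⟩
      5 ^ k                       ≤⟨ 5^k≤2+n ⟩
      suc (suc n)                 ≡⟨ +-comm 2 n ⟩
      n + 2                       ∎))

corollary2 : HasDensity (λ n → motzkin n % 5 ≟ 0) ((+ 1) /ℚ 10)
corollary2 = hasDensity-from-log-error (λ n → motzkin n % 5 ≟ 0) 9 100 zero-count-bound
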